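{- Let $(\xi,\rho)$ be a feasible solution of $RMP(\overline{\mathcal{R}},\overline{\mathcal{C}})$, let $o\in\mathcal{O}$ be an order and $r^*\in\overline{\mathcal{R}_o}$ a route for $o$. If $\rho_{or^*}>0$, then $\mathcal{L}(r^*)\subseteq Supp_o(\xi)$, where $\mathcal{L}(r^*)=\{l\in\mathcal{L}: a_{or^*}^l\ge1\}$ is the set of locations at which $r^*$ stops and $Supp_o(\xi)=\{l\in\mathcal{L}:\sum_{s\in\mathcal{S}(o)}\xi_{ls}>0\}$.
   Context: Data: a finite set $\mathcal{L}$ of storage locations, each $l$ with positive integer capacity $K_l$; a finite set $\mathcal{S}$ of SKUs; a finite set $\mathcal{O}$ of orders, each $o$ with SKU set $\mathcal{S}(o)\subseteq\mathcal{S}$; fixed assignments $\mathcal{F}\subseteq\mathcal{S}\times\mathcal{L}$. Storage nodes $\mathcal{V}=\bigcup_l\{v_l^1,\dots,v_l^{K_l}\}$, $\mathcal{V}(l)=\{v_l^1,\dots,v_l^{K_l}\}$, plus drop-off point $v_0$; directed graph $\mathcal{G}$ on $\mathcal{V}\cup\{v_0\}$ with arcs $(v_0,v_l^1)$, $(v_l^i,v_0)$, $(v_l^i,v_{l'}^1)$ for all $l,l'$ and $1\le i\le K_l$, and $(v_l^i,v_l^{i+1})$ for $1\le i\le K_l-1$. For each order $o$, $\mathcal{R}_o$ is the finite set of routes for $o$: tours in $\mathcal{G}$ starting and ending at $v_0$, visiting each node at most once and visiting exactly $|\mathcal{S}(o)|$ storage nodes; route $r$ has cost $c_{or}\in\mathbb{R}$;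 $a_{or}^l$ is the number of nodes of $\mathcal{V}(l)$ visited by $r$ (so $\sum_l a_{or}^l=|\mathcal{S}(o)|$); $b_{or}^l=1$ if $a_{or}^l\ge1$, else $0$; for $\overline{\mathcal{L}}\subseteq\mathcal{L}$, $\delta_r(\overline{\mathcal{L}})=1$ if $a_{or}^l\ge1$ for some $l\in\overline{\mathcal{L}}$, else $0$. Given subsets $\overline{\mathcal{R}_o}\subseteq\mathcal{R}_o$ for each $o$ (collectively $\overline{\mathcal{R}}$) and, for each $o\in\mathcal{O}$, $s\in\mathcal{S}(o)$, a finite family $\overline{\mathcal{C}_{os}}$ of location subsets $\mathcal{L}_c\subseteq\mathcal{L}$ with $|\mathcal{L}_c|\ge2$ (collectively $\overline{\mathcal{C}}$), the linear program $RMP(\overline{\mathcal{R}},\overline{\mathcal{C}})$ is: minimize $\sum_o\sum_{r\in\overline{\mathcal{R}_o}}c_{or}\rho_{or}$ subject to $\sum_s\xi_{ls}\le K_l$ ($l\in\mathcal{L}$); $\sum_l\xi_{ls}=1$ ($s\in\mathcal{S}$); $\xi_{ls}=1$ ($(s,l)\in\mathcal{F}$); $\sum_{r\in\overline{\mathcal{R}_o}}\rho_{or}=1$ ($o\in\mathcal{O}$); $\sum_{r\in\overline{\mathcal{R}_o}}a_{or}^l\rho_{or}\ge\sum_{s\in\mathcal{S}(o)}\xi_{ls}$ ($l,o$); $\sum_{r\in\overline{\mathcal{R}_o}}b_{or}^l\rho_{or}\ge\xi_{ls}$ ($l,o,s\in\mathcal{S}(o)$); $\sum_{r\in\overline{\mathcal{R}_o}}\delta_r(\mathcal{L}_c)\rho_{or}\ge\sum_{l\in\mathcal{L}_c}\xi_{ls}$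 ($o$, $s\in\mathcal{S}(o)$, $c\in\overline{\mathcal{C}_{os}}$); $\rho_{or}\ge0$, $\xi_{ls}\ge0$.
   Formalization: The entries of the feasible solution ξ and ρ, and the route costs $c_{or}$, take values in ℚ rather than in ℝ. -}

module Defs where

open import Data.Nat as ℕ using (ℕ; zero; suc)
open import Data.Integer using (+_)
open import Data.Fin as Fin using (Fin; toℕ)
open import Data.Fin.Subset using (Subset; ∣_∣)
open import Data.Vec using (lookup)
open import Data.Bool using (Bool; true; false; if_then_else_)
open import Data.List using (List; []; _∷_; length; filter)
open import Data.List.Relation.Unary.All using (All)
open import Data.List.Relation.Unary.Unique.Propositional using (Unique)
open import Data.Product using (Σ; _×_; _,_; proj₁; proj₂; ∃)
open import Data.Sum using (_⊎_)
open import Data.Unit using (⊤)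
open import Data.Empty using (⊥)
open import Function.Definitions using (Injective)
open import Relation.Binary.PropositionalEquality using (_≡_)
open import Relation.Unary using (Pred)
open import Relation.Nullary.Decidable using (does; _×-dec_)
open import Data.Fin.Properties using (any?)
import Data.Bool as B
open import Data.Rational as ℚ using (ℚ; 0ℚ; 1ℚ; _+_; _*_; _/_)

ℕ→ℚ : ℕ → ℚ
ℕ→ℚ n = (+ n) / 1

Σℚ : ∀ {n} → (Fin n → ℚ) → ℚ
Σℚ {zero}  f = 0ℚ
Σℚ {suc n} f = f Fin.zero + Σℚ (λ i → f (Fin.suc i))

Σℚ∈ : ∀ {n} → Subset n → (Fin n → ℚ) → ℚ
Σℚ∈ p f = Σℚ (λ i → if lookup p i then f i else 0ℚ)

-- Problem data: locations Fin nL with capacities K, SKUs Fin nS, orders Fin nO,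
-- order SKU sets S(o), fixed assignments F ⊆ S × L (finite list of pairs).
record Instance : Set where
  field
    nL nS nO : ℕ
    K     : Fin nL → ℕ
    K-pos : ∀ l → 1 ℕ.≤ K l
    S     : Fin nO → Subset nS
    F     : List (Fin nS × Fin nL)

module _ (I : Instance) where
  open Instance I

  -- storage node v_l^{i+1} is represented by (l , i) with i : Fin (K l)
  Node : Set
  Node = Σ (Fin nL) (λ l → Fin (K l))

  -- arcs between storage nodes: (v_l^i , v_l'^1) or (v_l^i , v_l^{i+1})
  Step : Node → Node → Set
  Step (l , i) (l' , j) = toℕ j ≡ 0 ⊎ (l ≡ l' × toℕ j ≡ suc (toℕ i))

  Chain : List Node → Set
  Chain []           = ⊤
  Chain (x ∷ [])     = ⊤
  Chain (x ∷ y ∷ xs) = Step x y × Chain (y ∷ xs)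

  -- first storage node must be some v_l^1 (only arcs out of v_0);
  -- every storage node has an arc back to v_0; no arc (v_0,v_0).
  Starts : List Node → Set
  Starts []            = ⊥
  Starts ((l , i) ∷ _) = toℕ i ≡ 0

  -- a route (tour v_0 → storage nodes → v_0) is represented by its sequence of
  -- storage nodes
  Route : Set
  Route = List Node

  IsRoute : Fin nO → Route → Set
  IsRoute o r = Starts r × Chain r × Unique r × length r ≡ ∣ S o ∣

  a : Route → Fin nL → ℕ
  a r l = length (filter (λ v → proj₁ v Fin.≟ l) r)

  b : Route → Fin nL → ℕ
  b r l with a r l
  ... | zero  = 0
  ... | suc _ = 1

  δ : Route → Subset nL → ℕ
  δ r Lc = if does (any? (λ l → (lookup Lc l B.≟ true) ×-dec (1 ℕ.≤? a r l))) then 1 else 0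

  -- the restricted route sets R̄_o (given as injective enumerations of valid
  -- routes), route costs, and the cut families C̄_os (subsets with ≥ 2 elements)
  record Columns : Set where
    field
      cost   : Fin nO → Route → ℚ
      nR     : Fin nO → ℕ
      route  : (o : Fin nO) → Fin (nR o) → Route
      route-valid : ∀ o k → IsRoute o (route o k)
      route-inj   : ∀ o → Injective _≡_ _≡_ (route o)
      nC     : Fin nO → Fin nS → ℕ
      cut    : (o : Fin nO) (s : Fin nS) → Fin (nC o s) → Subset nL
      cut-size : ∀ o s c → 2 ℕ.≤ ∣ cut o s c ∣

  module _ (Cl : Columns) where
    open Columns Cl

    -- feasibility of (ξ , ρ) for RMP(R̄, C̄); ξ l s = ξ_ls, ρ o k = ρ_{o,route o k}
    record Feasible (ξ : Fin nL → Fin nS → ℚ)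
                    (ρ : (o : Fin nO) → Fin (nR o) → ℚ) : Set where
      field
        capacity : ∀ l → Σℚ (λ s → ξ l s) ℚ.≤ ℕ→ℚ (K l)
        assign   : ∀ s → Σℚ (λ l → ξ l s) ≡ 1ℚ
        fixed    : All (λ p → ξ (proj₂ p) (proj₁ p) ≡ 1ℚ) F
        convex   : ∀ o → Σℚ (ρ o) ≡ 1ℚ
        count    : ∀ l o → Σℚ∈ (S o) (λ s → ξ l s)
                             ℚ.≤ Σℚ (λ k → ℕ→ℚ (a (route o k) l) * ρ o k)
        visit    : ∀ l o s → lookup (S o) s ≡ true
                     → ξ l s ℚ.≤ Σℚ (λ k → ℕ→ℚ (b (route o k) l) * ρ o k)
        cuts     : ∀ o s → lookup (S o) s ≡ true → ∀ c →
                     Σℚ∈ (cut o s c) (λ l → ξ l s)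
                       ℚ.≤ Σℚ (λ k → ℕ→ℚ (δ (route o k) (cut o s c)) * ρ o k)
        ρ-nonneg : ∀ o k → 0ℚ ℚ.≤ ρ o k
        ξ-nonneg : ∀ l s → 0ℚ ℚ.≤ ξ l s

  Stops : Route → Pred (Fin nL) _
  Stops r l = 1 ℕ.≤ a r l

  Supp : Fin nO → (Fin nL → Fin nS → ℚ) → Pred (Fin nL) _
  Supp o ξ l = 0ℚ ℚ.< Σℚ∈ (S o) (λ s → ξ l s)

-- Summed over all locations, both sides of the visit-count constraint of order o equal |S(o)|:
-- every SKU is assigned with total weight one, and every route of o visits exactly |S(o)| nodes
-- while the route weights sum to one. A family of pointwise inequalities with equal totals
-- consists of equalities, so Σ_{s ∈ S(o)} ξ_ls equals the expected number of visits to l, which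
-- is positive as soon as a route with positive weight stops at l.
module Submission where

open import Defs
open import Data.Fin using (Fin)
open import Data.Rational using (ℚ; 0ℚ; _<_)
open import Relation.Unary using (_⊆_)

open import Algebra.Bundles using (CommutativeMonoid)
open import Data.Bool using (true; false; if_then_else_)
open import Data.Fin.Subset using (Subset; ∣_∣)
import Data.Fin as Fin
import Data.Integer as ℤ
import Data.Integer.Properties as ℤ
open import Data.List using ([]; _∷_; length)
import Data.Nat as ℕ
open import Data.Nat.Coprimality using (1-coprimeTo)
import Data.Nat.Coprimality as Coprime
open import Data.Product using (proj₁; proj₂)
open import Data.Rational using (1ℚ; _+_; _*_; _/_; mkℚ; _≤_; positive; nonNegative)
open import Data.Rational.Properties
  using ( normalize-coprime; normalize-nonNeg; normalize-pos; pos*pos⇒pos; nonNeg*nonNeg⇒nonNeg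
        ; positive⁻¹; nonNegative⁻¹; +-0-commutativeMonoid
        ; +-identityˡ; +-identityʳ; *-zeroˡ; *-zeroʳ; *-identityʳ
        ; *-distribˡ-+; *-distribʳ-+
        ; ≤-refl; ≤-antisym; ≮⇒≥; <-irrefl; +-mono-≤; +-mono-<-≤; +-mono-≤-< )
open import Algebra.Properties.CommutativeSemigroup
  (CommutativeMonoid.commutativeSemigroup +-0-commutativeMonoid) using (interchange)
open import Data.Vec using ([]; _∷_; lookup)
open import Relation.Nullary using (does)
open import Relation.Binary.PropositionalEquality
  using (_≡_; refl; sym; trans; cong; cong₂; subst; module ≡-Reasoning)
open ≡-Reasoning

ℕ→ℚ≡mkℚ : ∀ m → ℕ→ℚ m ≡ mkℚ (ℤ.+ m) 0 (Coprime.sym (1-coprimeTo m))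
ℕ→ℚ≡mkℚ m = normalize-coprime (Coprime.sym (1-coprimeTo m))

ℕ→ℚ-+ : ∀ m n → ℕ→ℚ (m ℕ.+ n) ≡ ℕ→ℚ m + ℕ→ℚ n
ℕ→ℚ-+ m n = sym (begin
  ℕ→ℚ m + ℕ→ℚ n
    ≡⟨ cong₂ _+_ (ℕ→ℚ≡mkℚ m) (ℕ→ℚ≡mkℚ n) ⟩
  (ℤ.+ m ℤ.* ℤ.+ 1 ℤ.+ ℤ.+ n ℤ.* ℤ.+ 1) / 1
    ≡⟨ cong (_/ 1) (cong₂ ℤ._+_ (ℤ.*-identityʳ (ℤ.+ m)) (ℤ.*-identityʳ (ℤ.+ n))) ⟩
  ℕ→ℚ (m ℕ.+ n) ∎)

ℕ→ℚ-nonNeg : ∀ m → 0ℚ ≤ ℕ→ℚ m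
ℕ→ℚ-nonNeg m = nonNegative⁻¹ _ {{normalize-nonNeg m 1}}

ℕ→ℚ-pos : ∀ {m} → 1 ℕ.≤ m → 0ℚ < ℕ→ℚ m
ℕ→ℚ-pos {m} 1≤m = positive⁻¹ _ {{normalize-pos m 1 {{_}} {{ℕ.>-nonZero {m} 1≤m}}}}

Σℚ-cong : ∀ {n} {f g : Fin n → ℚ} → (∀ i → f i ≡ g i) → Σℚ f ≡ Σℚ g
Σℚ-cong {ℕ.zero}  f≗g = refl
Σℚ-cong {ℕ.suc n} f≗g = cong₂ _+_ (f≗g Fin.zero) (Σℚ-cong (λ i → f≗g (Fin.suc i)))

Σℚ-zero : ∀ n → Σℚ {n} (λ _ → 0ℚ) ≡ 0ℚ
Σℚ-zero ℕ.zero    = refl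
Σℚ-zero (ℕ.suc n) = trans (cong (0ℚ +_) (Σℚ-zero n)) (+-identityˡ 0ℚ)

Σℚ-distrib-+ : ∀ {n} (f g : Fin n → ℚ) → Σℚ (λ i → f i + g i) ≡ Σℚ f + Σℚ g
Σℚ-distrib-+ {ℕ.zero}  f g = refl
Σℚ-distrib-+ {ℕ.suc n} f g =
  trans (cong (f Fin.zero + g Fin.zero +_) (Σℚ-distrib-+ (λ i → f (Fin.suc i)) (λ i → g (Fin.suc i))))
        (interchange (f Fin.zero) (g Fin.zero) _ _)

Σℚ-*ˡ : ∀ {n} c (f : Fin n → ℚ) → Σℚ (λ i → c * f i) ≡ c * Σℚ f
Σℚ-*ˡ {ℕ.zero}  c f = sym (*-zeroʳ c)
Σℚ-*ˡ {ℕ.suc n} c f =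
  trans (cong (c * f Fin.zero +_) (Σℚ-*ˡ c (λ i → f (Fin.suc i)))) (sym (*-distribˡ-+ c (f Fin.zero) _))

Σℚ-*ʳ : ∀ {n} (f : Fin n → ℚ) c → Σℚ (λ i → f i * c) ≡ Σℚ f * c
Σℚ-*ʳ {ℕ.zero}  f c = sym (*-zeroˡ c)
Σℚ-*ʳ {ℕ.suc n} f c =
  trans (cong (f Fin.zero * c +_) (Σℚ-*ʳ (λ i → f (Fin.suc i)) c)) (sym (*-distribʳ-+ c (f Fin.zero) _))

Σℚ-comm : ∀ {m n} (f : Fin m → Fin n → ℚ) →
          Σℚ (λ i → Σℚ (λ j → f i j)) ≡ Σℚ (λ j → Σℚ (λ i → f i j))
Σℚ-comm {ℕ.zero}  {n} f = sym (Σℚ-zero n)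
Σℚ-comm {ℕ.suc m} {n} f =
  trans (cong (Σℚ (f Fin.zero) +_) (Σℚ-comm (λ i → f (Fin.suc i))))
        (sym (Σℚ-distrib-+ (f Fin.zero) _))

Σℚ-mono-≤ : ∀ {n} {f g : Fin n → ℚ} → (∀ i → f i ≤ g i) → Σℚ f ≤ Σℚ g
Σℚ-mono-≤ {ℕ.zero}  f≤g = ≤-refl
Σℚ-mono-≤ {ℕ.suc n} f≤g = +-mono-≤ (f≤g Fin.zero) (Σℚ-mono-≤ (λ i → f≤g (Fin.suc i)))

Σℚ-mono-< : ∀ {n} {f g : Fin n → ℚ} → (∀ i → f i ≤ g i) → ∀ j → f j < g j → Σℚ f < Σℚ g
Σℚ-mono-< f≤g Fin.zero    fj<gj = +-mono-<-≤ fj<gj (Σℚ-mono-≤ (λ i → f≤g (Fin.suc i)))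
Σℚ-mono-< f≤g (Fin.suc j) fj<gj = +-mono-≤-< (f≤g Fin.zero) (Σℚ-mono-< (λ i → f≤g (Fin.suc i)) j fj<gj)

Σℚ-pos : ∀ {n} {f : Fin n → ℚ} → (∀ i → 0ℚ ≤ f i) → ∀ j → 0ℚ < f j → 0ℚ < Σℚ f
Σℚ-pos {n} {f} f≥0 j fj>0 = subst (_< Σℚ f) (Σℚ-zero n) (Σℚ-mono-< f≥0 j fj>0)

Σℚ-tight : ∀ {n} {f g : Fin n → ℚ} → (∀ i → f i ≤ g i) → Σℚ f ≡ Σℚ g → ∀ j → f j ≡ g j
Σℚ-tight f≤g Σf≡Σg j = ≤-antisym (f≤g j) (≮⇒≥ (λ fj<gj → <-irrefl Σf≡Σg (Σℚ-mono-< f≤g j fj<gj)))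

Σℚ-if : ∀ {n} b (f : Fin n → ℚ) → Σℚ (λ i → if b then f i else 0ℚ) ≡ (if b then Σℚ f else 0ℚ)
Σℚ-if true      f = refl
Σℚ-if {n} false f = Σℚ-zero n

Σℚ∈-comm : ∀ {m n} (p : Subset n) (f : Fin m → Fin n → ℚ) →
           Σℚ (λ i → Σℚ∈ p (f i)) ≡ Σℚ∈ p (λ j → Σℚ (λ i → f i j))
Σℚ∈-comm p f = trans (Σℚ-comm (λ i j → if lookup p j then f i j else 0ℚ))
                     (Σℚ-cong (λ j → Σℚ-if (lookup p j) (λ i → f i j)))

Σℚ∈-one : ∀ {n} (p : Subset n) → Σℚ∈ p (λ _ → 1ℚ) ≡ ℕ→ℚ ∣ p ∣
Σℚ∈-one []          = refl
Σℚ∈-one (true ∷ p)  = trans (cong (1ℚ +_) (Σℚ∈-one p)) (sym (ℕ→ℚ-+ 1 ∣ p ∣))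
Σℚ∈-one (false ∷ p) = trans (+-identityˡ _) (Σℚ∈-one p)

-- Both clauses compute: `does (suc i ≟ suc j)` reduces to `does (i ≟ j)`.
Σℚ-indicator : ∀ {n} (i : Fin n) → Σℚ (λ j → ℕ→ℚ (if does (i Fin.≟ j) then 1 else 0)) ≡ 1ℚ
Σℚ-indicator {ℕ.suc n} Fin.zero    = trans (cong (1ℚ +_) (Σℚ-zero n)) (+-identityʳ 1ℚ)
Σℚ-indicator {ℕ.suc n} (Fin.suc i) = trans (+-identityˡ _) (Σℚ-indicator i)

module _ (I : Instance) where
  open Instance I

  a-∷ : ∀ v r l → a I (v ∷ r) l ≡ (if does (proj₁ v Fin.≟ l) then 1 else 0) ℕ.+ a I r l
  a-∷ v r l with does (proj₁ v Fin.≟ l)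
  ... | true  = refl
  ... | false = refl

  Σℚ-a≡length : ∀ r → Σℚ (λ l → ℕ→ℚ (a I r l)) ≡ ℕ→ℚ (length r)
  Σℚ-a≡length []      = Σℚ-zero nL
  Σℚ-a≡length (v ∷ r) = begin
    Σℚ (λ l → ℕ→ℚ (a I (v ∷ r) l))
      ≡⟨ Σℚ-cong (λ l → trans (cong ℕ→ℚ (a-∷ v r l)) (ℕ→ℚ-+ (at-v l) (a I r l))) ⟩
    Σℚ (λ l → ℕ→ℚ (at-v l) + ℕ→ℚ (a I r l))
      ≡⟨ Σℚ-distrib-+ (λ l → ℕ→ℚ (at-v l)) (λ l → ℕ→ℚ (a I r l)) ⟩
    Σℚ (λ l → ℕ→ℚ (at-v l)) + Σℚ (λ l → ℕ→ℚ (a I r l))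
      ≡⟨ cong₂ _+_ (Σℚ-indicator (proj₁ v)) (Σℚ-a≡length r) ⟩
    1ℚ + ℕ→ℚ (length r)
      ≡⟨ sym (ℕ→ℚ-+ 1 (length r)) ⟩
    ℕ→ℚ (length (v ∷ r)) ∎
    where
    at-v : Fin nL → ℕ.ℕ
    at-v l = if does (proj₁ v Fin.≟ l) then 1 else 0

  module _ (Cl : Columns I) where
    open Columns Cl

    assigned : (Fin nL → Fin nS → ℚ) → Fin nO → Fin nL → ℚ
    assigned ξ o l = Σℚ∈ (S o) (λ s → ξ l s)

    visits : ((o : Fin nO) → Fin (nR o) → ℚ) → (o : Fin nO) → Fin nL → ℚ
    visits ρ o l = Σℚ (λ k → ℕ→ℚ (a I (route o k) l) * ρ o k)

    Σℚ-assigned : ∀ {ξ} → (∀ s → Σℚ (λ l → ξ l s) ≡ 1ℚ) → ∀ o → Σℚ (assigned ξ o) ≡ ℕ→ℚ ∣ S o ∣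
    Σℚ-assigned {ξ} assign o = begin
      Σℚ (assigned ξ o)                     ≡⟨ Σℚ∈-comm (S o) ξ ⟩
      Σℚ∈ (S o) (λ s → Σℚ (λ l → ξ l s))   ≡⟨ Σℚ-cong (λ s → cong (if lookup (S o) s then_else 0ℚ) (assign s)) ⟩
      Σℚ∈ (S o) (λ _ → 1ℚ)                  ≡⟨ Σℚ∈-one (S o) ⟩
      ℕ→ℚ ∣ S o ∣                          ∎

    Σℚ-visits : ∀ {ρ} o → Σℚ (ρ o) ≡ 1ℚ → Σℚ (visits ρ o) ≡ ℕ→ℚ ∣ S o ∣
    Σℚ-visits {ρ} o convex = begin
      Σℚ (visits ρ o)
        ≡⟨ Σℚ-comm (λ l k → ℕ→ℚ (a I (route o k) l) * ρ o k) ⟩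
      Σℚ (λ k → Σℚ (λ l → ℕ→ℚ (a I (route o k) l) * ρ o k))
        ≡⟨ Σℚ-cong (λ k → Σℚ-*ʳ (λ l → ℕ→ℚ (a I (route o k) l)) (ρ o k)) ⟩
      Σℚ (λ k → Σℚ (λ l → ℕ→ℚ (a I (route o k) l)) * ρ o k)
        ≡⟨ Σℚ-cong (λ k → cong (_* ρ o k) (route-stops o k)) ⟩
      Σℚ (λ k → ℕ→ℚ ∣ S o ∣ * ρ o k)
        ≡⟨ Σℚ-*ˡ (ℕ→ℚ ∣ S o ∣) (ρ o) ⟩
      ℕ→ℚ ∣ S o ∣ * Σℚ (ρ o)
        ≡⟨ trans (cong (ℕ→ℚ ∣ S o ∣ *_) convex) (*-identityʳ _) ⟩
      ℕ→ℚ ∣ S o ∣ ∎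
      where
      route-stops : ∀ o k → Σℚ (λ l → ℕ→ℚ (a I (route o k) l)) ≡ ℕ→ℚ ∣ S o ∣
      route-stops o k = trans (Σℚ-a≡length (route o k)) (cong ℕ→ℚ (proj₂ (proj₂ (proj₂ (route-valid o k)))))

    visits-pos : ∀ {ρ} → (∀ o k → 0ℚ ≤ ρ o k) → ∀ o k → 0ℚ < ρ o k →
                 Stops I (route o k) ⊆ λ l → 0ℚ < visits ρ o l
    visits-pos {ρ} ρ≥0 o k ρ>0 {l} stop = Σℚ-pos term≥0 k term>0
      where
      term≥0 : ∀ k′ → 0ℚ ≤ ℕ→ℚ (a I (route o k′) l) * ρ o k′
      term≥0 k′ = nonNegative⁻¹ _ {{nonNeg*nonNeg⇒nonNeg (ℕ→ℚ (a I (route o k′) l))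
        {{nonNegative (ℕ→ℚ-nonNeg (a I (route o k′) l))}} (ρ o k′) {{nonNegative (ρ≥0 o k′)}}}}
      term>0 : 0ℚ < ℕ→ℚ (a I (route o k) l) * ρ o k
      term>0 = positive⁻¹ _ {{pos*pos⇒pos (ℕ→ℚ (a I (route o k) l)) {{positive (ℕ→ℚ-pos stop)}}
        (ρ o k) {{positive ρ>0}}}}

lemma1 : (I : Instance) (Cl : Columns I)
         (ξ : Fin (Instance.nL I) → Fin (Instance.nS I) → ℚ)
         (ρ : (o : Fin (Instance.nO I)) → Fin (Columns.nR Cl o) → ℚ)
         → Feasible I Cl ξ ρ
         → (o : Fin (Instance.nO I)) (k : Fin (Columns.nR Cl o))
         → 0ℚ < ρ o k
         → Stops I (Columns.route Cl o k) ⊆ Supp I o ξ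
lemma1 I Cl ξ ρ feasible o k ρ>0 {l} stop =
  subst (0ℚ <_) (sym assigned≡visits) (visits-pos I Cl ρ-nonneg o k ρ>0 stop)
  where
  open Feasible feasible
  assigned≡visits : assigned I Cl ξ o l ≡ visits I Cl ρ o l
  assigned≡visits = Σℚ-tight (λ l′ → count l′ o)
    (trans (Σℚ-assigned I Cl {ξ} assign o) (sym (Σℚ-visits I Cl {ρ} o (convex o)))) l
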